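{- Let $\sigma,\tau\in S_n$ and suppose $\sigma^{ -1}\tau$ is a product of $c$ disjoint cycles. Then there are exactly $2^{c}$ paths from the zero matrix $\hat 0$ to $P_\sigma+P_\tau$ in $M(n)$; that is, there are exactly $2^c$ ordered pairs $(P_{\tau_1},P_{\tau_2})$ of permutation matrices with $P_{\tau_1}+P_{\tau_2}=P_\sigma+P_\tau$.
   Context: $M(n)$ is the set of $n\times n$ matrices with non-negative integer entries all of whose row and column sums equal a common value (semi-magic squares), partially ordered by entrywise comparison. For $N\in M(n)$, a path from $\hat 0$ to $N$ is a maximal chain in the interval $[\hat0,N]$; covering steps are exactly additions of a permutation matrix, so a path from $\hat0$ to $N$ is an ordered sequence of permutation matrices summing to $N$. $P_\sigma$ denotes the permutation matrix of $\sigma$, with $P_\sigma P_\tau=P_{\sigma\tau}$. In the cycle decomposition, $c$ counts nontrivial cycles (fixed points are not counted). -}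

module Defs where

open import Data.Nat using (ℕ; zero; suc; _+_; _≤_)
open import Data.Fin using (Fin; toℕ)
open import Data.Fin.Properties using (_≟_)
open import Data.Vec using (Vec; lookup; tabulate; zipWith)
open import Data.Bool using (Bool; true; false; if_then_else_; _∧_)
open import Data.List using (List; length; filter)
open import Data.List.Base using (allFin)
open import Relation.Nullary using (¬_; does; Dec; yes; no)
open import Relation.Nullary.Decidable using (⌊_⌋; ¬?; _×-dec_)
open import Data.Nat.Properties using (_≤?_)
open import Data.Vec.Relation.Unary.All using () renaming (all? to vall?)
open import Relation.Binary.PropositionalEquality using (_≡_)

-- A permutation of Fin n, represented by its vector of images
-- (img ! i = σ(i)); injectivity is an irrelevant field, so two
-- permutations are equal iff their image vectors are equal.
record Perm (n : ℕ) : Set where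
  constructor perm
  field
    img  : Vec (Fin n) n
    .inj : ∀ i j → lookup img i ≡ lookup img j → i ≡ j
open Perm public

app : ∀ {n} → Perm n → Fin n → Fin n
app σ i = lookup (img σ) i

Mat : ℕ → Set
Mat n = Vec (Vec ℕ n) n

-- Permutation matrix: entry (i , j) is 1 iff σ(j) = i, so P σ e_j = e_{σ j}
-- and P σ · P τ = P (σ ∘ τ).
P : ∀ {n} → Perm n → Mat n
P σ = tabulate λ i → tabulate λ j → if does (app σ j ≟ i) then 1 else 0

_⊕_ : ∀ {n} → Mat n → Mat n → Mat n
A ⊕ B = zipWith (zipWith _+_) A B

iter : ∀ {n} → Perm n → ℕ → Fin n → Fin n
iter π zero i = i
iter π (suc k) i = app π (iter π k i)

isOrbitMin : ∀ {n} → Perm n → Fin n → Bool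
isOrbitMin {n} π i = ⌊ vall? (λ k → toℕ i ≤? toℕ (iter π (toℕ k) i))
                              (tabulate {n = n} (λ k → k)) ⌋

-- Number of nontrivial cycles of π (fixed points not counted):
-- each nontrivial cycle is counted once, via its least element.
cycles : ∀ {n} → Perm n → ℕ
cycles {n} π = length (filter (λ i → ¬? (app π i ≟ i) ×-dec T? (isOrbitMin π i)) (allFin n))
  where
  open import Data.Bool using (T)
  open import Data.Bool.Properties using (T?)

module Submission where

-- A pair (a , b) with P a + P b = P σ + P τ agrees with (σ , τ) column by column up to a swap,
-- so it is determined by the columns j with a j = σ j.  At a fixed point of π = σ⁻¹τ there is
-- no choice, since σ j = τ j.  Along a nontrivial cycle the choice is constant: as σ (π j) = τ j,
-- choosing differently at j and π j makes a or b take the same value twice.  Conversely every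
-- choice constant on the nontrivial cycles gives such a pair, so the pairs correspond to Boolean
-- vectors indexed by the nontrivial cycles, each represented by its least element.

open import Defs
open import Data.Nat using (ℕ; zero; suc; _+_; _*_; _∸_; _^_; _<_; _≤_)
open import Data.Nat.Properties
  using (n<1+n; ≤-trans; <⇒≤; ≤-pred; m∸n≤m; m<n⇒0<n∸m; m+[n∸m]≡n; +-comm; m≤m*n; +-cancelˡ-≡)
open import Data.Nat.DivMod using (_%_; _/_; m%n<n; m≡m%n+[m/n]*n)
import Data.Nat as ℕ
import Data.Fin as Fin
open import Data.Fin using (Fin; toℕ; fromℕ<)
open import Data.Fin.Properties
  using (_≟_; toℕ<n; toℕ-fromℕ<; pigeonhole; ≤-totalOrder; ≤-antisym; 2↔Bool)
open import Data.Vec using (Vec; lookup; tabulate; zipWith; _∷_; [])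
open import Data.Vec.Properties using (lookup∘tabulate; lookup-zipWith; ≡-dec)
open import Data.Vec.Relation.Binary.Pointwise.Extensional using (ext; Pointwise-≡⇒≡)
import Data.Vec.Relation.Unary.All.Properties as VecAll
import Data.List as List
open import Data.List using (List; length; filter; allFin)
import Data.List.Relation.Unary.All as All
open import Data.List.Relation.Unary.All.Properties using (all-filter)
open import Data.List.Relation.Unary.Any using (index)
open import Data.List.Relation.Unary.Any.Properties using (lookup-index)
open import Data.List.Membership.Propositional using (_∈_)
open import Data.List.Relation.Unary.Unique.Propositional using (Unique)
import Data.List.Relation.Unary.AllPairs as AllPairs
import Data.List.Relation.Unary.Unique.Propositional.Properties as Unique
import Data.List.Extrema as Extrema
open import Data.List.Membership.Propositional.Properties
  using (∈-tabulate⁺; ∈-tabulate⁻; ∈-filter⁺; ∈-allFin; ∈-lookup)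
open import Data.Bool using (Bool; true; false; if_then_else_; T; not)
open import Data.Bool.Properties using (T?)
open import Data.Product using (Σ; ∃; _×_; _,_; proj₁; proj₂)
open import Data.Sum using (_⊎_; inj₁; inj₂)
open import Relation.Nullary using (¬_; does; yes; no; contradiction)
open import Relation.Nullary.Decidable using (recompute; ¬?; _×-dec_; toWitness; fromWitness; dec-true; dec-false)
open import Function.Base using (_∘′_)
open import Function.Bundles using (_⤖_; _↔_; mk↔ₛ′)
open import Function.Properties.Inverse using (↔-trans; ↔-sym; ↔⇒⤖)
open import Data.Vec.Recursive using (Fin[m^n]↔Fin[m]^n; lift↔)
open import Data.Vec.Recursive.Properties using (↔Vec)
open import Relation.Binary.PropositionalEquality
open ≡-Reasoning
open import Axiom.UniquenessOfIdentityProofs using (module Decidable⇒UIP)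

app-injective : ∀ {n} (σ : Perm n) {i j} → app σ i ≡ app σ j → i ≡ j
app-injective (perm _ injective) {i} {j} eq = recompute (i ≟ j) (injective i j eq)

Perm-≡ : ∀ {n} {σ τ : Perm n} → (∀ i → app σ i ≡ app τ i) → σ ≡ τ
Perm-≡ {σ = perm v _} {perm w _} σ≗τ with Pointwise-≡⇒≡ {xs = v} {w} (ext σ≗τ)
... | refl = refl

fromInjective : ∀ {n} (f : Fin n → Fin n) → (∀ {i j} → f i ≡ f j → i ≡ j) → Perm n
fromInjective f f-injective = perm (tabulate f) λ i j eq →
  f-injective (trans (sym (lookup∘tabulate f i)) (trans eq (lookup∘tabulate f j)))

app-fromInjective : ∀ {n} (f : Fin n → Fin n) (f-injective : ∀ {i j} → f i ≡ f j → i ≡ j) j →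
                    app (fromInjective f f-injective) j ≡ f j
app-fromInjective f _ = lookup∘tabulate f

δ : ∀ {n} → Fin n → Fin n → ℕ
δ x i = if does (x ≟ i) then 1 else 0

δ-refl : ∀ {n} (x : Fin n) → δ x x ≡ 1
δ-refl x rewrite dec-true (x ≟ x) refl = refl

δ-≢ : ∀ {n} {x y : Fin n} → ¬ x ≡ y → δ x y ≡ 0
δ-≢ {x = x} {y} x≢y rewrite dec-false (x ≟ y) x≢y = refl

δ≡1⇒≡ : ∀ {n} {x y : Fin n} → δ x y ≡ 1 → x ≡ y
δ≡1⇒≡ {x = x} {y} δxy≡1 with x ≟ y
... | yes x≡y = x≡y
... | no _ with () ← δxy≡1

δ+δ-injective : ∀ {n} {a b s t : Fin n} → (∀ i → δ a i + δ b i ≡ δ s i + δ t i) →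
                (a ≡ s × b ≡ t) ⊎ (a ≡ t × b ≡ s)
δ+δ-injective {a = a} {b} {s} {t} eq with a ≟ s | b ≟ s
... | yes refl | _ = inj₁ (refl , δ≡1⇒≡ (trans (+-cancelˡ-≡ (δ a t) _ _ (eq t)) (δ-refl t)))
... | no _ | yes refl = inj₂ (δ≡1⇒≡ (+-cancelˡ-≡ (δ b t) _ _ (begin
  δ b t + δ a t   ≡⟨ +-comm (δ b t) (δ a t) ⟩
  δ a t + δ b t   ≡⟨ eq t ⟩
  δ b t + δ t t   ≡⟨ cong (δ b t +_) (δ-refl t) ⟩
  δ b t + 1       ∎)) , refl)
... | no a≢s | no b≢s with () ← begin
  0               ≡⟨ cong₂ _+_ (δ-≢ a≢s) (δ-≢ b≢s) ⟨
  δ a s + δ b s   ≡⟨ eq s ⟩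
  δ s s + δ t s   ≡⟨ cong (_+ δ t s) (δ-refl s) ⟩
  1 + δ t s       ∎

⊕-P-lookup : ∀ {n} (a b : Perm n) i j →
             lookup (lookup (P a ⊕ P b) i) j ≡ δ (app a j) i + δ (app b j) i
⊕-P-lookup a b i j = begin
  lookup (lookup (P a ⊕ P b) i) j
    ≡⟨ cong (λ r → lookup r j) (lookup-zipWith (zipWith _+_) i (P a) (P b)) ⟩
  lookup (zipWith _+_ (lookup (P a) i) (lookup (P b) i)) j
    ≡⟨ lookup-zipWith _+_ j (lookup (P a) i) (lookup (P b) i) ⟩
  lookup (lookup (P a) i) j + lookup (lookup (P b) i) j
    ≡⟨ cong₂ _+_ (P-lookup a) (P-lookup b) ⟩
  δ (app a j) i + δ (app b j) i
    ∎
  where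
  P-lookup : ∀ σ → lookup (lookup (P σ) i) j ≡ δ (app σ j) i
  P-lookup σ = trans (cong (λ r → lookup r j) (lookup∘tabulate _ i)) (lookup∘tabulate _ j)

SameColumn : ∀ {n} (a b s t : Perm n) → Fin n → Set
SameColumn a b s t j = (app a j ≡ app s j × app b j ≡ app t j)
                     ⊎ (app a j ≡ app t j × app b j ≡ app s j)

⊕-≡⇒SameColumn : ∀ {n} {a b s t : Perm n} → P a ⊕ P b ≡ P s ⊕ P t → ∀ j → SameColumn a b s t j
⊕-≡⇒SameColumn {a = a} {b} {s} {t} eq j = δ+δ-injective λ i →
  trans (sym (⊕-P-lookup a b i j)) (trans (cong (λ M → lookup (lookup M i) j) eq) (⊕-P-lookup s t i j))

SameColumn⇒⊕-≡ : ∀ {n} {a b s t : Perm n} → (∀ j → SameColumn a b s t j) → P a ⊕ P b ≡ P s ⊕ P t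
SameColumn⇒⊕-≡ {a = a} {b} {s} {t} same = Pointwise-≡⇒≡ (ext λ i → Pointwise-≡⇒≡ (ext λ j →
  trans (⊕-P-lookup a b i j) (trans (column (same j)) (sym (⊕-P-lookup s t i j)))))
  where
  column : ∀ {i j} → SameColumn a b s t j →
           δ (app a j) i + δ (app b j) i ≡ δ (app s j) i + δ (app t j) i
  column (inj₁ (a≡s , b≡t)) rewrite a≡s | b≡t = refl
  column {i} {j} (inj₂ (a≡t , b≡s)) rewrite a≡t | b≡s = +-comm (δ (app t j) i) (δ (app s j) i)

Paths : ∀ {n} → Perm n → Perm n → Set
Paths σ τ = Σ (Perm _ × Perm _) λ p → P (proj₁ p) ⊕ P (proj₂ p) ≡ P σ ⊕ P τ

Paths-≡ : ∀ {n} {σ τ : Perm n} {x y : Paths σ τ} → proj₁ x ≡ proj₁ y → x ≡ y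
Paths-≡ {x = p , eq} {.p , eq′} refl = cong (p ,_) (≡-irrelevant eq eq′)
  where open Decidable⇒UIP (≡-dec (≡-dec ℕ._≟_))

valueAt : ∀ {n} (keys : List (Fin n)) → Vec Bool (length keys) → Fin n → Bool
valueAt List.[]          []       x = false
valueAt (key List.∷ keys) (b ∷ bs) x = if does (key ≟ x) then b else valueAt keys bs x

valueAt-lookup : ∀ {n} {keys : List (Fin n)} → Unique keys →
                 (bs : Vec Bool (length keys)) (k : Fin (length keys)) →
                 valueAt keys bs (List.lookup keys k) ≡ lookup bs k
valueAt-lookup {keys = key List.∷ _} _ (b ∷ bs) Fin.zero rewrite dec-true (key ≟ key) refl = refl
valueAt-lookup {keys = key List.∷ keys} (key∉ AllPairs.∷ unique) (b ∷ bs) (Fin.suc k)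
  rewrite dec-false (key ≟ List.lookup keys k) (All.lookup key∉ (∈-lookup k)) = valueAt-lookup unique bs k

Fin[2^n]↔Vec-Bool : ∀ n → Fin (2 ^ n) ↔ Vec Bool n
Fin[2^n]↔Vec-Bool n = ↔-trans (Fin[m^n]↔Fin[m]^n 2 n) (↔-trans (lift↔ n 2↔Bool) (↔Vec n))

module Orbits {n : ℕ} (π : Perm n) where

  iter-+ : ∀ a b j → iter π (a + b) j ≡ iter π a (iter π b j)
  iter-+ zero    b j = refl
  iter-+ (suc a) b j = cong (app π) (iter-+ a b j)

  iter-injective : ∀ k {x y} → iter π k x ≡ iter π k y → x ≡ y
  iter-injective zero    eq = eq
  iter-injective (suc k) eq = iter-injective k (app-injective π eq)

  iter-* : ∀ q {p j} → iter π p j ≡ j → iter π (q * p) j ≡ j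
  iter-* zero    eq = refl
  iter-* (suc q) {p} {j} eq = begin
    iter π (p + q * p) j        ≡⟨ iter-+ p (q * p) j ⟩
    iter π p (iter π (q * p) j) ≡⟨ cong (iter π p) (iter-* q eq) ⟩
    iter π p j                  ≡⟨ eq ⟩
    j                           ∎

  period : ∀ j → Σ ℕ λ p → 0 < p × p ≤ n × iter π p j ≡ j
  period j with pigeonhole (n<1+n n) (λ (k : Fin (suc n)) → iter π (toℕ k) j)
  ... | a , b , a<b , eq = toℕ b ∸ toℕ a , m<n⇒0<n∸m a<b
                         , ≤-trans (m∸n≤m (toℕ b) (toℕ a)) (≤-pred (toℕ<n b))
                         , sym (iter-injective (toℕ a) πᵃj≡πᵃ⁺ᵈj)
    where
    πᵃj≡πᵃ⁺ᵈj : iter π (toℕ a) j ≡ iter π (toℕ a) (iter π (toℕ b ∸ toℕ a) j)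
    πᵃj≡πᵃ⁺ᵈj = trans eq (trans (cong (λ m → iter π m j) (sym (m+[n∸m]≡n (<⇒≤ a<b))))
                                (iter-+ (toℕ a) (toℕ b ∸ toℕ a) j))

  iter-below-n : ∀ j k → ∃ λ (k′ : Fin n) → iter π k j ≡ iter π (toℕ k′) j
  iter-below-n j k with period j
  ... | p@(suc _) , _ , p≤n , πᵖj≡j = fromℕ< k%p<n , (begin
    iter π k j                                ≡⟨ cong (λ m → iter π m j) (m≡m%n+[m/n]*n k p) ⟩
    iter π (k % p + k / p * p) j              ≡⟨ iter-+ (k % p) (k / p * p) j ⟩
    iter π (k % p) (iter π (k / p * p) j)     ≡⟨ cong (iter π (k % p)) (iter-* (k / p) πᵖj≡j) ⟩
    iter π (k % p) j                          ≡⟨ cong (λ m → iter π m j) (toℕ-fromℕ< k%p<n) ⟨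
    iter π (toℕ (fromℕ< k%p<n)) j             ∎)
    where
    k%p<n : k % p < n
    k%p<n = ≤-trans (m%n<n k p) p≤n

  Orbit : Fin n → Fin n → Set
  Orbit j x = ∃ λ k → iter π k j ≡ x

  Orbit-step : ∀ j → Orbit j (app π j)
  Orbit-step j = 1 , refl

  Orbit-trans : ∀ {j x y} → Orbit j x → Orbit x y → Orbit j y
  Orbit-trans {j} (k , refl) (l , refl) = l + k , iter-+ l k j

  Orbit-sym : ∀ {j x} → Orbit j x → Orbit x j
  Orbit-sym {j} (k , refl) with period j
  ... | p@(suc _) , _ , _ , πᵖj≡j = k * p ∸ k , (begin
    iter π (k * p ∸ k) (iter π k j) ≡⟨ iter-+ (k * p ∸ k) k j ⟨
    iter π (k * p ∸ k + k) j        ≡⟨ cong (λ m → iter π m j) k*p∸k+k≡k*p ⟩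
    iter π (k * p) j                ≡⟨ iter-* k πᵖj≡j ⟩
    j                               ∎)
    where
    k*p∸k+k≡k*p : k * p ∸ k + k ≡ k * p
    k*p∸k+k≡k*p = trans (+-comm (k * p ∸ k) k) (m+[n∸m]≡n (m≤m*n k p))

  open Extrema (≤-totalOrder n) using (min; argmin-sel; min≤xs)

  orbitMin : Fin n → Fin n
  orbitMin j = min j (List.tabulate λ (k : Fin n) → iter π (toℕ k) j)

  orbitMin-∈ : ∀ j → Orbit j (orbitMin j)
  orbitMin-∈ j with argmin-sel (λ x → x) j (List.tabulate λ (k : Fin n) → iter π (toℕ k) j)
  ... | inj₁ min≡j = 0 , sym min≡j
  ... | inj₂ min∈  = let k , min≡πᵏj = ∈-tabulate⁻ min∈ in toℕ k , sym min≡πᵏj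

  orbitMin-≤ : ∀ {j x} → Orbit j x → toℕ (orbitMin j) ≤ toℕ x
  orbitMin-≤ {j} (k , refl) with iter-below-n j k
  ... | k′ , πᵏj≡πᵏ′j = subst (λ x → toℕ (orbitMin j) ≤ toℕ x) (sym πᵏj≡πᵏ′j)
                              (All.lookup (min≤xs j _) (∈-tabulate⁺ k′))

  orbitMin-cong : ∀ {j x} → Orbit j x → orbitMin x ≡ orbitMin j
  orbitMin-cong {j} {x} o = ≤-antisym (orbitMin-≤ (Orbit-trans (Orbit-sym o) (orbitMin-∈ j)))
                                      (orbitMin-≤ (Orbit-trans o (orbitMin-∈ x)))

  isOrbitMin-orbitMin : ∀ j → T (isOrbitMin π (orbitMin j))
  isOrbitMin-orbitMin j =
    fromWitness (VecAll.tabulate⁺ λ k → orbitMin-≤ (Orbit-trans (orbitMin-∈ j) (toℕ k , refl)))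

  isOrbitMin⇒orbitMin≡ : ∀ {r} → T (isOrbitMin π r) → orbitMin r ≡ r
  isOrbitMin⇒orbitMin≡ {r} r-min with orbitMin-∈ r
  ... | k , πᵏr≡min with iter-below-n r k
  ... | k′ , πᵏr≡πᵏ′r = ≤-antisym (orbitMin-≤ (0 , refl))
    (subst (λ x → toℕ r ≤ toℕ x) (trans (sym πᵏr≡πᵏ′r) πᵏr≡min)
           (VecAll.tabulate⁻ (toWitness r-min) k′))

  NonFixed : Fin n → Set
  NonFixed x = ¬ app π x ≡ x

  NonFixed-Orbit : ∀ {j x} → Orbit j x → NonFixed j → NonFixed x
  NonFixed-Orbit (zero  , refl) j-moves = j-moves
  NonFixed-Orbit (suc k , refl) j-moves = NonFixed-Orbit (k , refl) j-moves ∘′ app-injective π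

  cycleMinima : List (Fin n)
  cycleMinima = filter (λ i → ¬? (app π i ≟ i) ×-dec T? (isOrbitMin π i)) (allFin n)

  cycleMinima-unique : Unique cycleMinima
  cycleMinima-unique = Unique.filter⁺ _ (Unique.allFin⁺ n)

  cycleMinima-lookup : ∀ k → let j = List.lookup cycleMinima k in NonFixed j × T (isOrbitMin π j)
  cycleMinima-lookup k = All.lookup (all-filter _ (allFin n)) (∈-lookup k)

  orbitMin∈cycleMinima : ∀ {j} → NonFixed j → orbitMin j ∈ cycleMinima
  orbitMin∈cycleMinima {j} j-moves =
    ∈-filter⁺ _ (∈-allFin _) (NonFixed-Orbit (orbitMin-∈ j) j-moves , isOrbitMin-orbitMin j)

module Decomposition {n} (σ τ π : Perm n) (σπ≗τ : ∀ i → app σ (app π i) ≡ app τ i) where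

  open Orbits π

  σ≡τ⇒≡π : ∀ {i k} → app σ i ≡ app τ k → i ≡ app π k
  σ≡τ⇒≡π {i} {k} σi≡τk = app-injective σ (trans σi≡τk (sym (σπ≗τ k)))

  σ≡τ-at-fixed : ∀ {j} → app π j ≡ j → app σ j ≡ app τ j
  σ≡τ-at-fixed {j} πj≡j = trans (cong (app σ) (sym πj≡j)) (σπ≗τ j)

  σ≢τ-at-NonFixed : ∀ {j} → NonFixed j → ¬ app σ j ≡ app τ j
  σ≢τ-at-NonFixed j-moves σj≡τj = j-moves (sym (σ≡τ⇒≡π σj≡τj))

  choose : Bool → Fin n → Fin n
  choose s j = if s then app σ j else app τ j

  choose-at-fixed : ∀ {j} → app π j ≡ j → ∀ s → choose s j ≡ app σ j
  choose-at-fixed _     true  = refl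
  choose-at-fixed πj≡j false = sym (σ≡τ-at-fixed πj≡j)

  does-choose : ∀ {j} → NonFixed j → ∀ s → does (choose s j ≟ app σ j) ≡ s
  does-choose {j} _       true  = dec-true (app σ j ≟ app σ j) refl
  does-choose {j} j-moves false = dec-false (app τ j ≟ app σ j) (σ≢τ-at-NonFixed j-moves ∘′ sym)

  Invariant : (Fin n → Bool) → Set
  Invariant s = ∀ j → s (app π j) ≡ s j

  -- σ i = τ k = σ (π k) forces i = π k, which has the same colour as k.
  choose-injective : ∀ {s} → Invariant s → ∀ {i k} → choose (s i) i ≡ choose (s k) k → i ≡ k
  choose-injective {s} s-inv {i} {k} eq with s i in sᵢ | s k in sₖ
  ... | true  | true  = app-injective σ eq
  ... | false | false = app-injective τ eq
  ... | true  | false with () ← trans (sym sᵢ) (trans (cong s (σ≡τ⇒≡π eq)) (trans (s-inv k) sₖ))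
  ... | false | true  with () ← trans (sym sₖ) (trans (cong s (σ≡τ⇒≡π (sym eq))) (trans (s-inv i) sᵢ))

  Invariant-not : ∀ {s} → Invariant s → Invariant (not ∘′ s)
  Invariant-not s-inv j = cong not (s-inv j)

  spliced : ∀ s → Invariant s → Perm n
  spliced s s-inv = fromInjective (λ j → choose (s j) j) (choose-injective s-inv)

  app-spliced : ∀ s (s-inv : Invariant s) j → app (spliced s s-inv) j ≡ choose (s j) j
  app-spliced s s-inv = app-fromInjective (λ j → choose (s j) j) (choose-injective s-inv)

  splice : ∀ s → Invariant s → Paths σ τ
  splice s s-inv = (spliced s s-inv , spliced (not ∘′ s) not-s-inv)
                 , SameColumn⇒⊕-≡ {a = spliced s s-inv} {spliced (not ∘′ s) not-s-inv} {σ} {τ} same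
    where
    not-s-inv : Invariant (not ∘′ s)
    not-s-inv = Invariant-not s-inv
    same : ∀ j → SameColumn (spliced s s-inv) (spliced (not ∘′ s) not-s-inv) σ τ j
    same j rewrite app-spliced s s-inv j | app-spliced (not ∘′ s) not-s-inv j with s j
    ... | true  = inj₁ (refl , refl)
    ... | false = inj₂ (refl , refl)

  module _ (x : Paths σ τ) where

    private
      a b : Perm n
      a = proj₁ (proj₁ x)
      b = proj₂ (proj₁ x)
      same : ∀ j → SameColumn a b σ τ j
      same = ⊕-≡⇒SameColumn {a = a} {b} {σ} {τ} (proj₂ x)

    colour : Fin n → Bool
    colour j = does (app a j ≟ app σ j)

    colour-true : ∀ {j} → app a j ≡ app σ j → colour j ≡ true
    colour-true {j} = dec-true (app a j ≟ app σ j)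

    colour-false : ∀ {j} → NonFixed j → app a j ≡ app τ j → colour j ≡ false
    colour-false {j} j-moves aj≡τj =
      dec-false (app a j ≟ app σ j) λ aj≡σj → σ≢τ-at-NonFixed j-moves (trans (sym aj≡σj) aj≡τj)

    -- Differently coloured columns j, π j would make a or b take the value σ (π j) = τ j twice.
    colour-π : ∀ {j} → NonFixed j → colour (app π j) ≡ colour j
    colour-π {j} j-moves with same j | same (app π j)
    ... | inj₁ (aj≡σj , _)    | inj₁ (aπj≡σπj , _) =
      trans (colour-true aπj≡σπj) (sym (colour-true aj≡σj))
    ... | inj₂ (aj≡τj , _)    | inj₂ (aπj≡τπj , _) =
      trans (colour-false (NonFixed-Orbit (Orbit-step j) j-moves) aπj≡τπj) (sym (colour-false j-moves aj≡τj))
    ... | inj₁ (_ , bj≡τj)    | inj₂ (_ , bπj≡σπj) =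
      contradiction (app-injective b (trans bπj≡σπj (trans (σπ≗τ j) (sym bj≡τj)))) j-moves
    ... | inj₂ (aj≡τj , _)    | inj₁ (aπj≡σπj , _) =
      contradiction (app-injective a (trans aπj≡σπj (trans (σπ≗τ j) (sym aj≡τj)))) j-moves

    colour-Orbit : ∀ {j y} → Orbit j y → NonFixed j → colour y ≡ colour j
    colour-Orbit (zero  , refl) _       = refl
    colour-Orbit (suc k , refl) j-moves =
      trans (colour-π (NonFixed-Orbit (k , refl) j-moves)) (colour-Orbit (k , refl) j-moves)

    column-choose : ∀ {j} s → (NonFixed j → s ≡ colour j) →
                    app a j ≡ choose s j × app b j ≡ choose (not s) j
    column-choose {j} s s≡colour with app π j ≟ j | same j
    ... | yes πj≡j | inj₁ (aj≡σj , bj≡τj) =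
      trans aj≡σj (sym (choose-at-fixed πj≡j s)) ,
      trans bj≡τj (trans (sym (σ≡τ-at-fixed πj≡j)) (sym (choose-at-fixed πj≡j (not s))))
    ... | yes πj≡j | inj₂ (aj≡τj , bj≡σj) =
      trans aj≡τj (trans (sym (σ≡τ-at-fixed πj≡j)) (sym (choose-at-fixed πj≡j s))) ,
      trans bj≡σj (sym (choose-at-fixed πj≡j (not s)))
    ... | no j-moves | inj₁ (aj≡σj , bj≡τj)
      rewrite s≡colour j-moves | colour-true aj≡σj = aj≡σj , bj≡τj
    ... | no j-moves | inj₂ (aj≡τj , bj≡σj)
      rewrite s≡colour j-moves | colour-false j-moves aj≡τj = aj≡τj , bj≡σj

  encode : Paths σ τ → Vec Bool (length cycleMinima)
  encode x = tabulate (colour x ∘′ List.lookup cycleMinima)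

  -- On a fixed point j the key orbitMin j = j is absent and valueAt returns false; harmless, as σ j = τ j.
  orbitColouring : Vec Bool (length cycleMinima) → Fin n → Bool
  orbitColouring v = valueAt cycleMinima v ∘′ orbitMin

  orbitColouring-invariant : ∀ v → Invariant (orbitColouring v)
  orbitColouring-invariant v j = cong (valueAt cycleMinima v) (orbitMin-cong (Orbit-step j))

  decode : Vec Bool (length cycleMinima) → Paths σ τ
  decode v = splice (orbitColouring v) (orbitColouring-invariant v)

  encode-decode : ∀ v → encode (decode v) ≡ v
  encode-decode v = Pointwise-≡⇒≡ (ext lookup-encode-decode)
    where
    s : Fin n → Bool
    s = orbitColouring v
    lookup-encode-decode : ∀ k → lookup (encode (decode v)) k ≡ lookup v k
    lookup-encode-decode k = begin
      lookup (encode (decode v)) k                          ≡⟨ lookup∘tabulate _ k ⟩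
      does (app (spliced s (orbitColouring-invariant v)) j ≟ app σ j)
        ≡⟨ cong (λ y → does (y ≟ app σ j)) (app-spliced s (orbitColouring-invariant v) j) ⟩
      does (choose (s j) j ≟ app σ j)                       ≡⟨ does-choose j-moves (s j) ⟩
      s j                                                   ≡⟨ cong (valueAt cycleMinima v) (isOrbitMin⇒orbitMin≡ j-min) ⟩
      valueAt cycleMinima v j                               ≡⟨ valueAt-lookup cycleMinima-unique v k ⟩
      lookup v k                                            ∎
      where
      j : Fin n
      j = List.lookup cycleMinima k
      j-moves : NonFixed j
      j-moves = proj₁ (cycleMinima-lookup k)
      j-min : T (isOrbitMin π j)
      j-min = proj₂ (cycleMinima-lookup k)

  valueAt-encode : ∀ x {j} → NonFixed j → valueAt cycleMinima (encode x) (orbitMin j) ≡ colour x j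
  valueAt-encode x {j} j-moves = begin
    valueAt cycleMinima (encode x) (orbitMin j)
      ≡⟨ cong (valueAt cycleMinima (encode x)) (lookup-index min∈) ⟩
    valueAt cycleMinima (encode x) (List.lookup cycleMinima k)
      ≡⟨ valueAt-lookup cycleMinima-unique (encode x) k ⟩
    lookup (encode x) k                              ≡⟨ lookup∘tabulate _ k ⟩
    colour x (List.lookup cycleMinima k)             ≡⟨ cong (colour x) (lookup-index min∈) ⟨
    colour x (orbitMin j)                            ≡⟨ colour-Orbit x (orbitMin-∈ j) j-moves ⟩
    colour x j                                       ∎
    where
    min∈ : orbitMin j ∈ cycleMinima
    min∈ = orbitMin∈cycleMinima j-moves
    k : Fin (length cycleMinima)
    k = index min∈

  decode-encode : ∀ x → decode (encode x) ≡ x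
  decode-encode x = Paths-≡ {σ = σ} {τ} (cong₂ _,_
    (Perm-≡ λ j → trans (app-spliced s s-inv j) (sym (proj₁ (chosen j))))
    (Perm-≡ λ j → trans (app-spliced (not ∘′ s) (Invariant-not s-inv) j) (sym (proj₂ (chosen j)))))
    where
    s : Fin n → Bool
    s = orbitColouring (encode x)
    s-inv : Invariant s
    s-inv = orbitColouring-invariant (encode x)
    chosen : ∀ j → app (proj₁ (proj₁ x)) j ≡ choose (s j) j
                 × app (proj₂ (proj₁ x)) j ≡ choose (not (s j)) j
    chosen j = column-choose x (s j) (valueAt-encode x)

  Paths↔Vec-Bool : Paths σ τ ↔ Vec Bool (cycles π)
  Paths↔Vec-Bool = mk↔ₛ′ encode decode encode-decode decode-encode

corollary4p3 : (n : ℕ) (σ τ π : Perm n) →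
    -- π = σ⁻¹τ, i.e. σ ∘ π = τ
    (∀ i → app σ (app π i) ≡ app τ i) →
    -- paths from 0 to P σ + P τ: ordered pairs (τ₁ , τ₂) with P τ₁ + P τ₂ = P σ + P τ
    Fin (2 ^ cycles π) ⤖ Σ (Perm n × Perm n) (λ p → P (proj₁ p) ⊕ P (proj₂ p) ≡ P σ ⊕ P τ)
corollary4p3 n σ τ π σπ≗τ =
  ↔⇒⤖ (↔-trans (Fin[2^n]↔Vec-Bool (cycles π)) (↔-sym (Paths↔Vec-Bool σ τ π σπ≗τ)))
  where open Decomposition using (Paths↔Vec-Bool)
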